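{- Let $G=(V,E)$ be a chordal graph and $\mathcal{T}$ its clique forest. Then for every node $v \in V$, the maximum weight spanning forest of $\mathcal{W}_G[\phi(v)]$ (with respect to the order $<$) equals the tree $\mathcal{T}(v) = \mathcal{T}[\phi(v)]$.
   Context: $G$ is a finite graph whose nodes carry distinct integer IDs; $G$ is chordal if every cycle of length at least 4 has a chord. Let $\mathcal{C}$ be the family of maximal cliques of $G$. For $v \in V$, $\phi(v) \subseteq \mathcal{C}$ is the set of maximal cliques containing $v$. The weighted clique intersection graph $\mathcal{W}_G$ has vertex set $\mathcal{C}$, an edge $C_iC_j$ whenever $C_i \cap C_j \neq \emptyset$, with weight $|C_i \cap C_j|$. For $C \in \mathcal{C}$ let $\sigma(C)$ be the word listing the IDs of the nodes of $C$ in increasing order. To an edge $e=C_iC_j$ associate the triple $(w_e,l_e,h_e)$ with $w_e=|C_i\cap C_j|$, $l_e$ the lexicographic minimum and $h_e$ the lexicographic maximum of $\{\sigma(C_i),\sigma(C_j)\}$; define $e<f$ iff $(w_e,l_e,h_e)$ is smaller than $(w_f,l_f,h_f)$ in the lexicographic comparison of triples (weights compared numerically, words lexicographically). This is a linear order on edges refining the weight order. For any induced subgraph of $\mathcal{W}_G$, its maximum weight spanning forest (with respect to $<$) is the unique spanning forest obtained by preferring edges larger with respect to $<$, i.e., the one produced by Kruskal's greedy algorithm processing edges in decreasing $<$-order; it is a maximum weight spanning forest. The clique forest $\mathcal{T}$ of $G$ is the maximum weight spanning forest of $\mathcal{W}_G$ in this sense; it is a forest on $\mathcal{C}$ such that for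 every node $v$, $\phi(v)$ induces a tree $\mathcal{T}(v) := \mathcal{T}[\phi(v)]$. -}

module Defs where

open import Data.Nat as ℕ using (ℕ; _≤_)
open import Data.Integer as ℤ using (ℤ)
import Data.Integer.Properties as ℤP
open import Data.Fin using (Fin; toℕ)
open import Data.Fin.Subset using (Subset; _∈_; _⊆_; _∩_; ∣_∣; Nonempty)
open import Data.Fin.Subset.Properties using (_∈?_)
open import Data.List using (List; map; filter; allFin)
open import Data.List.Relation.Binary.Lex.Strict using (Lex-<; <-decidable)
open import Data.Bool using (Bool; true; false; if_then_else_)
open import Data.Product using (Σ; ∃; ∃₂; _×_; _,_)
open import Data.Sum using (_⊎_)
open import Relation.Nullary using (¬_; does)
open import Relation.Binary.PropositionalEquality using (_≡_; _≢_)
open import Relation.Binary.Construct.Closure.ReflexiveTransitive using (Star)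
open import Function.Definitions using (Injective)
import Data.List.Sort

record Graph : Set where
  field
    n      : ℕ
    ID     : Fin n → ℤ
    ID-inj : Injective _≡_ _≡_ ID
    adj    : Fin n → Fin n → Bool
    sym    : ∀ i j → adj i j ≡ adj j i
    irrefl : ∀ i → adj i i ≡ false

module _ (G : Graph) where
  open Graph G

  Edge : Fin n → Fin n → Set
  Edge i j = adj i j ≡ true

  CycSucc : (k : ℕ) → Fin k → Fin k → Set
  CycSucc k i j = (toℕ j ≡ ℕ.suc (toℕ i)) ⊎ ((ℕ.suc (toℕ i) ≡ k) × (toℕ j ≡ 0))

  IsCycle : (k : ℕ) → (Fin k → Fin n) → Set
  IsCycle k f = Injective _≡_ _≡_ f × (∀ i j → CycSucc k i j → Edge (f i) (f j))

  HasChord : (k : ℕ) → (Fin k → Fin n) → Set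
  HasChord k f = ∃₂ λ i j → i ≢ j × ¬ CycSucc k i j × ¬ CycSucc k j i × Edge (f i) (f j)

  Chordal : Set
  Chordal = ∀ k (f : Fin k → Fin n) → 4 ≤ k → IsCycle k f → HasChord k f

  IsClique : Subset n → Set
  IsClique C = ∀ i j → i ∈ C → j ∈ C → i ≢ j → Edge i j

  IsMaxClique : Subset n → Set
  IsMaxClique C = IsClique C × (∀ D → IsClique D → C ⊆ D → D ⊆ C)

  φ : Fin n → Subset n → Set
  φ v C = IsMaxClique C × v ∈ C

  open Data.List.Sort ℤP.≤-decTotalOrder using (sort)

  σ : Subset n → List ℤ
  σ C = sort (map ID (filter (_∈? C) (allFin n)))

  _<ʷ_ : List ℤ → List ℤ → Set
  _<ʷ_ = Lex-< _≡_ ℤ._<_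

  lexMin lexMax : List ℤ → List ℤ → List ℤ
  lexMin x y = if does (<-decidable ℤ._≟_ ℤ._<?_ x y) then x else y
  lexMax x y = if does (<-decidable ℤ._≟_ ℤ._<?_ x y) then y else x

  w : Subset n → Subset n → ℕ
  w C D = ∣ C ∩ D ∣

  l h : Subset n → Subset n → List ℤ
  l C D = lexMin (σ C) (σ D)
  h C D = lexMax (σ C) (σ D)

  EdgeLt : Subset n → Subset n → Subset n → Subset n → Set
  EdgeLt C D C' D' =
    (w C D ℕ.< w C' D')
    ⊎ (w C D ≡ w C' D' ×
        ((l C D <ʷ l C' D')
         ⊎ (l C D ≡ l C' D' × h C D <ʷ h C' D')))

  -- Induced subgraph of W_G on the set of maximal cliques satisfying P
  -- (P is assumed to imply IsMaxClique): C D is an edge iff C ≠ D,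
  -- both satisfy P and C ∩ D ≠ ∅.

  WEdge : (Subset n → Set) → Subset n → Subset n → Set
  WEdge P C D = P C × P D × C ≢ D × Nonempty (C ∩ D)

  -- Maximum weight spanning forest w.r.t. < (Kruskal's output): the
  -- edge e = C D is selected iff C and D are not joined by a path of
  -- edges of the graph that are strictly larger than e.
  InMSF : (Subset n → Set) → Subset n → Subset n → Set
  InMSF P C D =
    WEdge P C D × ¬ Star (λ X Y → WEdge P X Y × EdgeLt C D X Y) C D

  InCliqueForest : Subset n → Subset n → Set
  InCliqueForest = InMSF IsMaxClique

{-# OPTIONS --safe #-}
module Submission where

-- A path of heavier edges inside W_G[φ(v)] is one in W_G, so only the converse needs work.
-- Send each maximal clique X to a maximal clique project X through v (X itself when v ∈ X).
-- An edge XY of W_G heavier than CD becomes a path of such edges inside φ(v): if X ∩ Y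
-- contains a vertex outside N[v], X and Y lie on the same component of G − N[v] and have
-- the same projection; otherwise X ∩ Y ⊆ project X ∩ project Y, which contains v as well,
-- so the weight strictly grows unless v ∈ X ∩ Y already and nothing moves.  Projecting a
-- heavier W_G-path from C to D therefore gives one inside φ(v).

open import Defs
open import Data.Fin using (Fin)
open import Data.Fin.Subset using (Subset; _∈_)
open import Data.Product using (_×_)
open import Function.Bundles using (_⇔_)

open import Data.Bool as Bool using (true; false)
open import Data.Empty using (⊥-elim)
open import Data.Fin as Fin using (toℕ)
open import Data.Fin.Properties using (any?; toℕ-injective; toℕ≤pred[n])
open import Data.Fin.Subset using (_∉_; _⊆_; _∩_; _∪_; ⁅_⁆; ∣_∣)
open import Data.Fin.Subset.Properties
  using (_∈?_; x∈p∩q⁺; x∈p∩q⁻; x∈p∪q⁺; x∈p∪q⁻; p⊆p∪q; x∈⁅x⁆; x∈⁅y⁆⇒x≡y; ⊆-antisym; p⊂q⇒∣p∣<∣q∣; ∣p∣≤n)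
open import Data.List using (List; _∷_; foldr; allFin)
open import Data.List.Membership.Propositional using () renaming (_∈_ to _∈ˡ_)
open import Data.List.Membership.Propositional.Properties using (∈-allFin)
open import Data.List.Relation.Unary.Any using (here; there)
open import Data.Nat using (ℕ; zero; suc; _+_; _≤_; _<_; z≤n; s≤s; _<?_; _≤?_)
open import Data.Nat.GeneralisedArithmetic using (fold)
open import Data.Nat.Induction using (<-rec)
open import Data.Nat.Properties
  using (<-cmp; ≤-refl; <⇒≤; ≤-<-trans; <-≤-trans; <-trans; ≤∧≢⇒<; ≰⇒>; m≤m+n; +-monoˡ-<; +-monoˡ-≤;
         +-suc; +-comm; +-assoc; suc-injective; m≤n⇒∃[o]m+o≡n; <⇒≱; n<1+n; m<n⇒m<1+n)
open import Data.Product using (∃; ∃₂; _,_; proj₁; proj₂; map₁; map₂)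
import Data.Sum as Sum
open import Data.Sum using (_⊎_; inj₁; inj₂; [_,_])
open import Data.Vec using (tabulate)
open import Data.Vec.Properties using (lookup∘tabulate; lookup⇒[]=; []=⇒lookup; ≡-dec)
open import Function using (_∘_; id)
open import Function.Bundles using (mk⇔)
open import Relation.Binary using (DecidableEquality; tri<; tri≈; tri>)
open import Relation.Binary.Construct.Closure.ReflexiveTransitive
  using (Star; ε; _◅_; _◅◅_; gmap; reverse; kleisliStar)
open import Relation.Binary.PropositionalEquality
  using (_≡_; _≢_; refl; sym; trans; cong; subst; subst₂; module ≡-Reasoning)
open import Relation.Nullary using (¬_; Dec; yes; no; does; ¬?; _×-dec_; _⊎-dec_)
open import Relation.Nullary.Decidable using (dec-true; decidable-stable)

module _ {n : ℕ} where

  toSubset : {P : Fin n → Set} → (∀ x → Dec (P x)) → Subset n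
  toSubset P? = tabulate (does ∘ P?)

  module _ {P : Fin n → Set} (P? : ∀ x → Dec (P x)) {x : Fin n} where

    ∈-toSubset⁺ : P x → x ∈ toSubset P?
    ∈-toSubset⁺ p = lookup⇒[]= x _ (trans (lookup∘tabulate (does ∘ P?) x) (dec-true (P? x) p))

    ∈-toSubset⁻ : x ∈ toSubset P? → P x
    ∈-toSubset⁻ x∈ with P? x | trans (sym (lookup∘tabulate (does ∘ P?) x)) ([]=⇒lookup x∈)
    ... | yes p | _ = p
    ... | no _ | ()

  module _ (f : Subset n → Subset n) (inflationary : ∀ S → S ⊆ f S) (S : Subset n) where

    fold-grows-or-stable : ∀ k → k ≤ ∣ fold S f k ∣ ⊎ f (fold S f k) ≡ fold S f k
    fold-grows-or-stable zero = inj₁ z≤n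
    fold-grows-or-stable (suc k) with fold-grows-or-stable k
    ... | inj₂ stable = inj₂ (cong f stable)
    ... | inj₁ k≤∣T∣ with any? (λ x → x ∈? f (fold S f k) ×-dec ¬? (x ∈? fold S f k))
    ...   | yes (x , x∈fT , x∉T) = inj₁ (≤-<-trans k≤∣T∣ (p⊂q⇒∣p∣<∣q∣ (inflationary _ , x , x∈fT , x∉T)))
    ...   | no noNew = inj₂ (cong f (⊆-antisym fT⊆T (inflationary _)))
      where
        fT⊆T : f (fold S f k) ⊆ fold S f k
        fT⊆T {x} x∈fT = decidable-stable (x ∈? fold S f k) (λ x∉T → noNew (x , x∈fT , x∉T))

    inflationary-fixpoint : f (fold S f (suc n)) ≡ fold S f (suc n)
    inflationary-fixpoint with fold-grows-or-stable (suc n)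
    ... | inj₁ n<∣T∣ = ⊥-elim (<⇒≱ n<∣T∣ (∣p∣≤n (fold S f (suc n))))
    ... | inj₂ stable = stable

module Reachability {n : ℕ} {E : Fin n → Fin n → Set} (E? : ∀ x y → Dec (E x y)) where

  entersFrom? : ∀ S y → Dec (∃ λ x → x ∈ S × E x y)
  entersFrom? S y = any? (λ x → x ∈? S ×-dec E? x y)

  reachStep : Subset n → Subset n
  reachStep S = S ∪ toSubset (entersFrom? S)

  reach : Subset n → Subset n
  reach S = fold S reachStep (suc n)

  reach-sound : ∀ S {y} → y ∈ reach S → ∃ λ x → x ∈ S × Star E x y
  reach-sound S = go (suc n)
    where
      go : ∀ k {y} → y ∈ fold S reachStep k → ∃ λ x → x ∈ S × Star E x y
      go zero {y} y∈S = y , y∈S , ε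
      go (suc k) y∈ with x∈p∪q⁻ (fold S reachStep k) _ y∈
      ... | inj₁ y∈T = go k y∈T
      ... | inj₂ y∈new with ∈-toSubset⁻ (entersFrom? _) y∈new
      ...   | z , z∈T , z→y with go k z∈T
      ...     | x , x∈S , x→z = x , x∈S , (x→z ◅◅ (z→y ◅ ε))

  reach-complete : ∀ S {x y} → x ∈ S → Star E x y → y ∈ reach S
  reach-complete S x∈S = closed (⊆-fold (suc n) x∈S)
    where
      ⊆-fold : ∀ k → S ⊆ fold S reachStep k
      ⊆-fold zero x∈S = x∈S
      ⊆-fold (suc k) x∈S = p⊆p∪q _ (⊆-fold k x∈S)

      closed : ∀ {x y} → x ∈ reach S → Star E x y → y ∈ reach S
      closed x∈ ε = x∈
      closed x∈ (x→z ◅ z→y) = closed z∈ z→y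
        where
          z∈ = subst (_ ∈_) (inflationary-fixpoint reachStep (λ T → p⊆p∪q _) S)
                 (x∈p∪q⁺ (inj₂ (∈-toSubset⁺ (entersFrom? _) (_ , x∈ , x→z))))

module _ {A : Set} where

  _◂_ : A → (ℕ → A) → ℕ → A
  (x ◂ s) zero = x
  (x ◂ s) (suc m) = s m

  module _ {R : A → A → Set} where

    length : ∀ {a b} → Star R a b → ℕ
    length ε = 0
    length (_ ◅ r) = suc (length r)

    trace : ∀ {a b} → Star R a b → A → ℕ → A
    trace {a} r z zero = a
    trace ε z (suc m) = z
    trace (_ ◅ r) z (suc m) = trace r z m

    trace-end : ∀ {a b} (r : Star R a b) z → trace r z (suc (length r)) ≡ z
    trace-end ε z = refl
    trace-end (_ ◅ r) z = trace-end r z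

    trace-all : {P : A → Set} → (∀ {x y} → R x y → P y) →
                ∀ {a b} (r : Star R a b) z → P a → ∀ m → m < suc (length r) → P (trace r z m)
    trace-all R⇒P r z Pa zero _ = Pa
    trace-all R⇒P (x→y ◅ r) z Pa (suc m) (s≤s m<) = trace-all R⇒P r z (R⇒P x→y) m m<

    trace-steps : {U : A → A → Set} → (∀ {x y} → R x y → U x y) →
                  ∀ {a b} (r : Star R a b) z → U b z →
                  ∀ m → m < suc (length r) → U (trace r z m) (trace r z (suc m))
    trace-steps R⇒U ε z Ubz zero _ = Ubz
    trace-steps R⇒U ε z Ubz (suc m) (s≤s ())
    trace-steps R⇒U (x→y ◅ r) z Ubz zero _ = R⇒U x→y
    trace-steps R⇒U (x→y ◅ r) z Ubz (suc m) (s≤s m<) = trace-steps R⇒U r z Ubz m m<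

injective-or-repeat : ∀ {A : Set} → DecidableEquality A → ∀ N (c : ℕ → A) →
  (∀ {a b : Fin (suc N)} → c (toℕ a) ≡ c (toℕ b) → a ≡ b) ⊎ ∃₂ λ i j → i < j × j ≤ N × c i ≡ c j
injective-or-repeat _≟_ N c with any? (λ a → any? (λ b → (toℕ a <? toℕ b) ×-dec (c (toℕ a) ≟ c (toℕ b))))
... | yes (a , b , a<b , repeat) = inj₂ (toℕ a , toℕ b , a<b , toℕ≤pred[n] b , repeat)
... | no noRepeat = inj₁ injective
  where
    injective : ∀ {a b : Fin (suc N)} → c (toℕ a) ≡ c (toℕ b) → a ≡ b
    injective {a} {b} ca≡cb with <-cmp (toℕ a) (toℕ b)
    ... | tri< a<b _ _ = ⊥-elim (noRepeat (a , b , a<b , ca≡cb))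
    ... | tri≈ _ a≡b _ = toℕ-injective a≡b
    ... | tri> _ _ b<a = ⊥-elim (noRepeat (b , a , b<a , sym ca≡cb))

-- skipIndex i δ enumerates 0 … i, i + 1 + δ, i + 2 + δ, …
skipIndex : ℕ → ℕ → ℕ → ℕ
skipIndex i δ zero = zero
skipIndex zero δ (suc m) = suc m + δ
skipIndex (suc i) δ (suc m) = suc (skipIndex i δ m)

skipIndex-≤ : ∀ {i m} δ → m ≤ i → skipIndex i δ m ≡ m
skipIndex-≤ δ z≤n = refl
skipIndex-≤ {suc i} δ (s≤s m≤i) = cong suc (skipIndex-≤ δ m≤i)

skipIndex-> : ∀ {i m} δ → i < m → skipIndex i δ m ≡ m + δ
skipIndex-> {zero} {suc m} δ _ = refl
skipIndex-> {suc i} {suc m} δ (s≤s i<m) = cong suc (skipIndex-> δ i<m)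

gap-decomposition : ∀ {i j L} → suc i < j → j ≤ L →
                    ∃₂ λ δ L′ → j ≡ suc i + δ × L ≡ L′ + δ × i < L′ × L′ < L
gap-decomposition {i} 1+i<j j≤L with m≤n⇒∃[o]m+o≡n 1+i<j | m≤n⇒∃[o]m+o≡n j≤L
... | a , refl | b , refl =
  suc a , suc (i + b) , cong suc (sym (+-suc i a)) , cong suc L≡ , s≤s (m≤m+n i b) ,
  s≤s (s≤s (+-monoˡ-≤ b (m≤m+n i a)))
  where
    L≡ : suc (i + a + b) ≡ i + b + suc a
    L≡ = begin
      suc (i + a + b)   ≡⟨ cong suc (+-assoc i a b) ⟩
      suc (i + (a + b)) ≡⟨ cong (λ t → suc (i + t)) (+-comm a b) ⟩
      suc (i + (b + a)) ≡⟨ cong suc (sym (+-assoc i b a)) ⟩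
      suc (i + b + a)   ≡⟨ sym (+-suc (i + b) a) ⟩
      i + b + suc a     ∎
      where open ≡-Reasoning

module _ (G : Graph) where
  open Graph G using (n; adj; irrefl) renaming (sym to adj-sym)

  Edge? : ∀ x y → Dec (Edge G x y)
  Edge? x y = adj x y Bool.≟ true

  edge-sym : ∀ {x y} → Edge G x y → Edge G y x
  edge-sym {x} {y} x~y = trans (adj-sym y x) x~y

  edge⇒≢ : ∀ {x y} → Edge G x y → x ≢ y
  edge⇒≢ {x} x~x refl with trans (sym x~x) (irrefl x)
  ... | ()

  Far : Fin n → Fin n → Set
  Far u x = x ≢ u × adj x u ≡ false

  Far? : ∀ u x → Dec (Far u x)
  Far? u x = ¬? (x Fin.≟ u) ×-dec (adj x u Bool.≟ false)

  far⇒¬edge : ∀ {u x} → Far u x → ¬ Edge G x u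
  far⇒¬edge (_ , x≁u) x~u with trans (sym x~u) x≁u
  ... | ()

  ¬far⇒edge : ∀ {u x} → x ≢ u → ¬ Far u x → Edge G x u
  ¬far⇒edge {u} {x} x≢u notFar with adj x u
  ... | true = refl
  ... | false = ⊥-elim (notFar (x≢u , refl))

  Blocked : Subset n → Fin n → Set
  Blocked X u = ∃ λ x → x ∈ X × Far u x

  blocked? : ∀ X u → Dec (Blocked X u)
  blocked? X u = any? (λ x → x ∈? X ×-dec Far? u x)

  Blocked-mono : ∀ {X Y u} → X ⊆ Y → Blocked X u → Blocked Y u
  Blocked-mono X⊆Y (x , x∈X , far) = x , X⊆Y x∈X , far

  unblocked⇒edge : ∀ {X u x} → ¬ Blocked X u → x ∈ X → x ≢ u → Edge G x u
  unblocked⇒edge ¬blocked x∈X x≢u = ¬far⇒edge x≢u (λ far → ¬blocked (_ , x∈X , far))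

  ∪⁅⁆-isClique : ∀ {X u} → IsClique G X → ¬ Blocked X u → IsClique G (X ∪ ⁅ u ⁆)
  ∪⁅⁆-isClique {X} {u} clq ¬blocked a b a∈ b∈ a≢b with x∈p∪q⁻ X ⁅ u ⁆ a∈ | x∈p∪q⁻ X ⁅ u ⁆ b∈
  ... | inj₁ a∈X | inj₁ b∈X = clq a b a∈X b∈X a≢b
  ... | inj₁ a∈X | inj₂ b∈u with refl ← x∈⁅y⁆⇒x≡y u b∈u = unblocked⇒edge ¬blocked a∈X a≢b
  ... | inj₂ a∈u | inj₁ b∈X with refl ← x∈⁅y⁆⇒x≡y u a∈u =
    edge-sym (unblocked⇒edge ¬blocked b∈X (a≢b ∘ sym))
  ... | inj₂ a∈u | inj₂ b∈u = ⊥-elim (a≢b (trans (x∈⁅y⁆⇒x≡y u a∈u) (sym (x∈⁅y⁆⇒x≡y u b∈u))))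

  maxClique-absorbs : ∀ {X u} → IsMaxClique G X → ¬ Blocked X u → u ∈ X
  maxClique-absorbs {X} {u} (clq , maximal) ¬blocked =
    maximal (X ∪ ⁅ u ⁆) (∪⁅⁆-isClique clq ¬blocked) (p⊆p∪q _) (x∈p∪q⁺ (inj₂ (x∈⁅x⁆ u)))

  maxClique-blocks : ∀ {X u} → IsMaxClique G X → u ∉ X → Blocked X u
  maxClique-blocks {X} {u} mX u∉X with blocked? X u
  ... | yes blocked = blocked
  ... | no ¬blocked = ⊥-elim (u∉X (maxClique-absorbs mX ¬blocked))

  insert : Fin n → Subset n → Subset n
  insert u X with blocked? X u
  ... | yes _ = X
  ... | no _ = X ∪ ⁅ u ⁆

  ⊆-insert : ∀ u X → X ⊆ insert u X
  ⊆-insert u X with blocked? X u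
  ... | yes _ = id
  ... | no _ = p⊆p∪q _

  insert-isClique : ∀ u {X} → IsClique G X → IsClique G (insert u X)
  insert-isClique u {X} clq with blocked? X u
  ... | yes _ = clq
  ... | no ¬blocked = ∪⁅⁆-isClique clq ¬blocked

  insert-settles : ∀ u X → u ∈ insert u X ⊎ Blocked X u
  insert-settles u X with blocked? X u
  ... | yes blocked = inj₂ blocked
  ... | no _ = inj₁ (x∈p∪q⁺ (inj₂ (x∈⁅x⁆ u)))

  insertAll : List (Fin n) → Subset n → Subset n
  insertAll us K = foldr insert K us

  ⊆-insertAll : ∀ us K → K ⊆ insertAll us K
  ⊆-insertAll List.[] K = id
  ⊆-insertAll (u ∷ us) K = ⊆-insert u _ ∘ ⊆-insertAll us K

  insertAll-isClique : ∀ us {K} → IsClique G K → IsClique G (insertAll us K)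
  insertAll-isClique List.[] clq = clq
  insertAll-isClique (u ∷ us) clq = insert-isClique u (insertAll-isClique us clq)

  insertAll-settles : ∀ {u} us K → u ∈ˡ us → u ∈ insertAll us K ⊎ Blocked (insertAll us K) u
  insertAll-settles (u ∷ us) K (here refl) =
    Sum.map id (Blocked-mono (⊆-insert u _)) (insert-settles u (insertAll us K))
  insertAll-settles (w ∷ us) K (there u∈us) =
    Sum.map (⊆-insert w _) (Blocked-mono (⊆-insert w _)) (insertAll-settles us K u∈us)

  extend : Subset n → Subset n
  extend = insertAll (allFin n)

  ⊆-extend : ∀ K → K ⊆ extend K
  ⊆-extend = ⊆-insertAll (allFin n)

  extend-isMaxClique : ∀ {K} → IsClique G K → IsMaxClique G (extend K)
  extend-isMaxClique {K} clq = insertAll-isClique (allFin n) clq , maximal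
    where
      maximal : ∀ D → IsClique G D → extend K ⊆ D → D ⊆ extend K
      maximal D clqD ext⊆D {d} d∈D with insertAll-settles (allFin n) K (∈-allFin d)
      ... | inj₁ d∈ext = d∈ext
      ... | inj₂ (x , x∈ext , far) = ⊥-elim (far⇒¬edge far (clqD x d (ext⊆D x∈ext) d∈D (proj₁ far)))

  FarEdge : Fin n → Fin n → Fin n → Set
  FarEdge u x y = Far u x × Far u y × Edge G x y

  FarEdge-sym : ∀ {u x y} → FarEdge u x y → FarEdge u y x
  FarEdge-sym (x-far , y-far , x~y) = y-far , x-far , edge-sym x~y

  Star-far : ∀ {u x y} → Far u x → Star (FarEdge u) x y → Far u y
  Star-far x-far ε = x-far
  Star-far _ ((_ , z-far , _) ◅ z→y) = Star-far z-far z→y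

  IsWalk : ℕ → (ℕ → Fin n) → Set
  IsWalk L s = ∀ m → m < L → Edge G (s m) (s (suc m))

  ◂-walk : ∀ {x L s} → Edge G x (s 0) → IsWalk L s → IsWalk (suc L) (x ◂ s)
  ◂-walk x~s0 walk zero _ = x~s0
  ◂-walk x~s0 walk (suc m) (s≤s m<L) = walk m m<L

  NonConsecutive : ℕ → ℕ → ℕ → Set
  NonConsecutive N i j = i < j × j ≤ N × suc i ≢ j × ¬ (i ≡ 0 × j ≡ N)

  chord-nonConsecutive : ∀ {N} {a b : Fin (suc N)} → toℕ a < toℕ b →
    ¬ CycSucc G (suc N) a b → ¬ CycSucc G (suc N) b a → NonConsecutive N (toℕ a) (toℕ b)
  chord-nonConsecutive {b = b} a<b ¬ab ¬ba =
    a<b , toℕ≤pred[n] b , (λ e → ¬ab (inj₁ (sym e))) , (λ (a≡0 , b≡N) → ¬ba (inj₂ (cong suc b≡N , a≡0)))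

  -- Closed up through v, a detour is a cycle of length L + 2 with no chord at v.
  record Detour (v : Fin n) (L : ℕ) (s : ℕ → Fin n) : Set where
    field
      walk         : IsWalk L s
      start        : Edge G v (s 0)
      end          : Edge G v (s L)
      ends-far     : Far (s L) (s 0)
      interior-far : ∀ m → 0 < m → m < L → Far v (s m)

  detour-skip : ∀ {v L δ s i} → Detour v (L + δ) s → i < L → Edge G (s i) (s (suc i + δ)) →
                Detour v L (s ∘ skipIndex i δ)
  detour-skip {v} {L} {δ} {s} {i} d i<L chord = record
    { walk         = walk′
    ; start        = start
    ; end          = subst (Edge G v ∘ s) (sym (skipIndex-> δ i<L)) end
    ; ends-far     = subst (λ m → Far (s m) (s 0)) (sym (skipIndex-> δ i<L)) ends-far
    ; interior-far = interior-far′
    }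
    where
      open Detour d

      walk′ : IsWalk L (s ∘ skipIndex i δ)
      walk′ m m<L with <-cmp m i
      ... | tri< m<i _ _ rewrite skipIndex-≤ δ (<⇒≤ m<i) | skipIndex-≤ δ m<i =
        walk m (<-≤-trans m<L (m≤m+n L δ))
      ... | tri≈ _ refl _ rewrite skipIndex-≤ δ (≤-refl {m}) | skipIndex-> δ (n<1+n m) = chord
      ... | tri> _ _ i<m rewrite skipIndex-> δ i<m | skipIndex-> δ (m<n⇒m<1+n i<m) =
        walk (m + δ) (+-monoˡ-< δ m<L)

      interior-far′ : ∀ m → 0 < m → m < L → Far v (s (skipIndex i δ m))
      interior-far′ m 0<m m<L with m ≤? i
      ... | yes m≤i rewrite skipIndex-≤ δ m≤i = interior-far m 0<m (<-≤-trans m<L (m≤m+n L δ))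
      ... | no m≰i rewrite skipIndex-> δ (≰⇒> m≰i) =
        interior-far (m + δ) (<-≤-trans 0<m (m≤m+n m δ)) (+-monoˡ-< δ m<L)

  ShorterDetour : Fin n → ℕ → Set
  ShorterDetour v L = ∃₂ λ L′ s′ → L′ < L × Detour v L′ s′

  -- a repeat s i = s j with j < L gives the chord s i — s (j + 1), and j = L is impossible
  detour-shortcut : ∀ {v L s i j} → Detour v L s → suc i < j → j ≤ L →
                    s i ≡ s j ⊎ Edge G (s i) (s j) → ShorterDetour v L
  detour-shortcut {v} {L} {s} {i} {j} d 1+i<j j≤L (inj₂ chord)
    with gap-decomposition 1+i<j j≤L
  ... | δ , L′ , refl , refl , i<L′ , L′<L = L′ , _ , L′<L , detour-skip d i<L′ chord
  detour-shortcut {v} {L} {s} {i} {j} d 1+i<j j≤L (inj₁ repeat) with <-cmp j L | i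
  ... | tri< j<L _ _ | _ =
    detour-shortcut d (<-trans 1+i<j (n<1+n j)) j<L
      (inj₂ (subst (λ x → Edge G x (s (suc j))) (sym repeat) (Detour.walk d j j<L)))
  ... | tri≈ _ refl _ | zero = ⊥-elim (proj₁ (Detour.ends-far d) repeat)
  ... | tri≈ _ refl _ | suc i′ =
    ⊥-elim (far⇒¬edge (Detour.interior-far d (suc i′) (s≤s z≤n) (<-trans (n<1+n _) 1+i<j))
                      (edge-sym (subst (Edge G v) (sym repeat) (Detour.end d))))
  ... | tri> _ _ L<j | _ = ⊥-elim (<⇒≱ L<j j≤L)

  module _ (chordal : Chordal G) where

    closedWalk-chord : ∀ N (c : ℕ → Fin n) → 3 ≤ N → IsWalk N c → Edge G (c N) (c 0) →
      ∃₂ λ i j → NonConsecutive N i j × (c i ≡ c j ⊎ Edge G (c i) (c j))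
    closedWalk-chord N c 3≤N walk close with injective-or-repeat Fin._≟_ N c
    ... | inj₂ (i , j , i<j , j≤N , repeat) =
      i , j , (i<j , j≤N , notStep , notWrap) , inj₁ repeat
      where
        notStep : suc i ≢ j
        notStep refl = edge⇒≢ (walk i j≤N) repeat
        notWrap : ¬ (i ≡ 0 × j ≡ N)
        notWrap (refl , refl) = edge⇒≢ close (sym repeat)
    ... | inj₁ injective with chordal (suc N) (c ∘ toℕ) (s≤s 3≤N) (injective , cycle)
      where
        cycle : ∀ a b → CycSucc G (suc N) a b → Edge G (c (toℕ a)) (c (toℕ b))
        cycle a b (inj₁ b≡1+a) =
          subst (Edge G (c (toℕ a)) ∘ c) (sym b≡1+a) (walk (toℕ a) (subst (_≤ N) b≡1+a (toℕ≤pred[n] b)))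
        cycle a b (inj₂ (1+a≡1+N , b≡0)) =
          subst₂ (λ i j → Edge G (c i) (c j)) (sym (suc-injective 1+a≡1+N)) (sym b≡0) close
    ... | a , b , a≢b , ¬ab , ¬ba , a~b with <-cmp (toℕ a) (toℕ b)
    ...   | tri< a<b _ _ = toℕ a , toℕ b , chord-nonConsecutive a<b ¬ab ¬ba , inj₂ a~b
    ...   | tri≈ _ a≡b _ = ⊥-elim (a≢b (toℕ-injective a≡b))
    ...   | tri> _ _ b<a = toℕ b , toℕ a , chord-nonConsecutive b<a ¬ba ¬ab , inj₂ (edge-sym a~b)

    no-detour : ∀ {v} L s → ¬ Detour v L s
    no-detour {v} = <-rec (λ L → ∀ s → ¬ Detour v L s) go
      where
        go : ∀ L → (∀ {L′} → L′ < L → ∀ s → ¬ Detour v L′ s) → ∀ s → ¬ Detour v L s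
        go zero _ s d = proj₁ (Detour.ends-far d) refl
        go (suc zero) _ s d = far⇒¬edge (Detour.ends-far d) (Detour.walk d 0 (s≤s z≤n))
        go L@(suc (suc _)) shorter s d
          with closedWalk-chord (suc L) (v ◂ s) (s≤s (s≤s (s≤s z≤n)))
                 (◂-walk (Detour.start d) (Detour.walk d)) (edge-sym (Detour.end d))
        ... | zero , suc j , (_ , s≤s j≤L , 1≢1+j , notWrap) , v≈sj =
          [ (λ v≡sj → proj₁ far (sym v≡sj)) , (λ v~sj → far⇒¬edge far (edge-sym v~sj)) ] v≈sj
          where
            far : Far v (s j)
            far = Detour.interior-far d j (≤∧≢⇒< z≤n (1≢1+j ∘ cong suc))
                                          (≤∧≢⇒< j≤L (λ j≡L → notWrap (refl , cong suc j≡L)))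
        ... | suc i , suc j , (s≤s i<j , s≤s j≤L , 2+i≢1+j , _) , si≈sj
          with detour-shortcut d (≤∧≢⇒< i<j (2+i≢1+j ∘ cong suc)) j≤L si≈sj
        ...   | L′ , s′ , L′<L , d′ = shorter L′<L s′ d′

    far-walk-neighbours-adjacent : ∀ {v x y a b} → x ≢ y → Edge G v x → Edge G v y →
      Far v a → Edge G x a → Star (FarEdge v) a b → Edge G b y → Edge G x y
    far-walk-neighbours-adjacent {v} {x} {y} x≢y v~x v~y a-far x~a a→b b~y with adj x y in x≁y
    ... | true = refl
    ... | false = ⊥-elim (no-detour _ (x ◂ trace a→b y) detour)
      where
        detour : Detour v (suc (suc (length a→b))) (x ◂ trace a→b y)
        detour = record
          { walk         = ◂-walk x~a (trace-steps (proj₂ ∘ proj₂) a→b y b~y)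
          ; start        = v~x
          ; end          = subst (Edge G v) (sym (trace-end a→b y)) v~y
          ; ends-far     = subst (λ z → Far z x) (sym (trace-end a→b y)) (x≢y , x≁y)
          ; interior-far = λ { (suc m) _ (s≤s m<) → trace-all (proj₁ ∘ proj₂) a→b y a-far m m< }
          }

  HeavierEdge : (Subset n → Set) → Subset n → Subset n → Subset n → Subset n → Set
  HeavierEdge P C D X Y = WEdge G P X Y × EdgeLt G C D X Y

  WEdge-mono : ∀ {P Q : Subset n → Set} → (∀ {X} → P X → Q X) → ∀ {X Y} → WEdge G P X Y → WEdge G Q X Y
  WEdge-mono P⇒Q (PX , PY , X≢Y , meet) = P⇒Q PX , P⇒Q PY , X≢Y , meet

  EdgeLt-by-weight : ∀ {C D X Y P Q} → EdgeLt G C D X Y → w G X Y < w G P Q → EdgeLt G C D P Q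
  EdgeLt-by-weight (inj₁ CD<XY) XY<PQ = inj₁ (<-trans CD<XY XY<PQ)
  EdgeLt-by-weight (inj₂ (CD≡XY , _)) XY<PQ = inj₁ (subst (_< _) (sym CD≡XY) XY<PQ)

-- For v ∉ X, project X is a maximal clique through v containing every neighbour of v in X:
-- it extends {v} ∪ (N(v) ∩ N(F)), F the component of G − N[v] meeting X, which is a clique
-- because G is chordal.  It depends only on F, so cliques sharing a vertex far from v
-- project to the same clique.
module Projection (G : Graph) (chordal : Chordal G) (v : Fin (Graph.n G)) where
  open Graph G using (n)

  FarEdge? : ∀ x y → Dec (FarEdge G v x y)
  FarEdge? x y = Far? G v x ×-dec Far? G v y ×-dec Edge? G x y

  open Reachability FarEdge?

  farRegion : Subset n
  farRegion = toSubset (Far? G v)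

  farComponent : Subset n → Subset n
  farComponent X = reach (X ∩ farRegion)

  far∈farComponent : ∀ {X x} → x ∈ X → Far G v x → x ∈ farComponent X
  far∈farComponent x∈X far =
    reach-complete (_ ∩ farRegion) (x∈p∩q⁺ (x∈X , ∈-toSubset⁺ (Far? G v) far)) ε

  farRoot : ∀ {X d} → d ∈ farComponent X → ∃ λ x → (x ∈ X × Far G v x) × Star (FarEdge G v) x d
  farRoot {X} d∈ with reach-sound (X ∩ farRegion) d∈
  ... | x , x∈ , x→d = x , map₂ (∈-toSubset⁻ (Far? G v)) (x∈p∩q⁻ X farRegion x∈) , x→d

  farComponent-far : ∀ {X d} → d ∈ farComponent X → Far G v d
  farComponent-far d∈ with farRoot d∈
  ... | _ , (_ , x-far) , x→d = Star-far G x-far x→d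

  clique-farLink : ∀ {X x y} → IsClique G X → x ∈ X → y ∈ X → Far G v x → Far G v y →
                   Star (FarEdge G v) x y
  clique-farLink {x = x} {y} clq x∈X y∈X x-far y-far with x Fin.≟ y
  ... | yes refl = ε
  ... | no x≢y = (x-far , y-far , clq x y x∈X y∈X x≢y) ◅ ε

  farComponent-linked : ∀ {X d d′} → IsClique G X → d ∈ farComponent X → d′ ∈ farComponent X →
                        Star (FarEdge G v) d d′
  farComponent-linked clq d∈ d′∈ with farRoot d∈ | farRoot d′∈
  ... | x , (x∈X , x-far) , x→d | y , (y∈X , y-far) , y→d′ =
    reverse (FarEdge-sym G) x→d ◅◅ clique-farLink clq x∈X y∈X x-far y-far ◅◅ y→d′

  farComponent-⊆ : ∀ {X Y u} → IsClique G X → u ∈ X → u ∈ Y → Far G v u → farComponent X ⊆ farComponent Y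
  farComponent-⊆ clq u∈X u∈Y u-far d∈ with farRoot d∈
  ... | x , (x∈X , x-far) , x→d =
    reach-complete (_ ∩ farRegion) (x∈p∩q⁺ (u∈Y , ∈-toSubset⁺ (Far? G v) u-far))
      (clique-farLink clq u∈X x∈X u-far x-far ◅◅ x→d)

  Attached : Subset n → Fin n → Set
  Attached F u = u ≡ v ⊎ (Edge G v u × ∃ λ d → d ∈ F × Edge G u d)

  attached? : ∀ F u → Dec (Attached F u)
  attached? F u = (u Fin.≟ v) ⊎-dec (Edge? G v u ×-dec any? (λ d → d ∈? F ×-dec Edge? G u d))

  attached-adjacent : ∀ {X a b} → IsClique G X → a ≢ b →
                      Attached (farComponent X) a → Attached (farComponent X) b → Edge G a b
  attached-adjacent _ a≢b (inj₁ refl) (inj₁ refl) = ⊥-elim (a≢b refl)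
  attached-adjacent _ _ (inj₁ refl) (inj₂ (v~b , _)) = v~b
  attached-adjacent _ _ (inj₂ (v~a , _)) (inj₁ refl) = edge-sym G v~a
  attached-adjacent clq a≢b (inj₂ (v~a , d , d∈ , a~d)) (inj₂ (v~b , d′ , d′∈ , b~d′)) =
    far-walk-neighbours-adjacent G chordal a≢b v~a v~b (farComponent-far d∈) a~d
      (farComponent-linked clq d∈ d′∈) (edge-sym G b~d′)

  attachment : Subset n → Subset n
  attachment X = toSubset (attached? (farComponent X))

  attachment-isClique : ∀ {X} → IsClique G X → IsClique G (attachment X)
  attachment-isClique {X} clq a b a∈ b∈ a≢b =
    attached-adjacent clq a≢b (∈-toSubset⁻ (attached? (farComponent X)) a∈)
                              (∈-toSubset⁻ (attached? (farComponent X)) b∈)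

  project : Subset n → Subset n
  project X with v ∈? X
  ... | yes _ = X
  ... | no _ = extend G (attachment X)

  project-∈ : ∀ {X} → v ∈ X → project X ≡ X
  project-∈ {X} v∈X with v ∈? X
  ... | yes _ = refl
  ... | no v∉X = ⊥-elim (v∉X v∈X)

  project-∉ : ∀ {X} → v ∉ X → project X ≡ extend G (attachment X)
  project-∉ {X} v∉X with v ∈? X
  ... | yes v∈X = ⊥-elim (v∉X v∈X)
  ... | no _ = refl

  project-φ : ∀ {X} → IsMaxClique G X → φ G v (project X)
  project-φ {X} mX with v ∈? X
  ... | yes v∈X = mX , v∈X
  ... | no _ = extend-isMaxClique G (attachment-isClique (proj₁ mX)) ,
               ⊆-extend G _ (∈-toSubset⁺ (attached? (farComponent X)) (inj₁ refl))

  project-keeps : ∀ {X u} → IsMaxClique G X → u ∈ X → ¬ Far G v u → u ∈ project X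
  project-keeps {X} {u} mX u∈X near with v ∈? X
  ... | yes _ = u∈X
  ... | no v∉X with maxClique-blocks G mX v∉X
  ...   | d , d∈X , d-far =
    ⊆-extend G _ (∈-toSubset⁺ (attached? (farComponent X))
      (inj₂ (v~u , d , far∈farComponent d∈X d-far , proj₁ mX u d u∈X d∈X u≢d)))
    where
      v~u : Edge G v u
      v~u = edge-sym G (¬far⇒edge G (λ u≡v → v∉X (subst (_∈ X) u≡v u∈X)) near)
      u≢d : u ≢ d
      u≢d refl = near d-far

  far-excludes : ∀ {X u} → IsClique G X → u ∈ X → Far G v u → v ∉ X
  far-excludes clq u∈X u-far v∈X = far⇒¬edge G u-far (clq _ v u∈X v∈X (proj₁ u-far))

  project-shared-far : ∀ {X Y u} → IsMaxClique G X → IsMaxClique G Y → u ∈ X → u ∈ Y → Far G v u →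
                       project X ≡ project Y
  project-shared-far {X} {Y} (clqX , _) (clqY , _) u∈X u∈Y u-far = begin
    project X                  ≡⟨ project-∉ (far-excludes clqX u∈X u-far) ⟩
    extend G (attachment X)    ≡⟨ cong (extend G ∘ toSubset ∘ attached?) sameComponent ⟩
    extend G (attachment Y)    ≡⟨ project-∉ (far-excludes clqY u∈Y u-far) ⟨
    project Y                  ∎
    where
      open ≡-Reasoning
      sameComponent : farComponent X ≡ farComponent Y
      sameComponent = ⊆-antisym (farComponent-⊆ clqX u∈X u∈Y u-far) (farComponent-⊆ clqY u∈Y u∈X u-far)

  φ-link : ∀ {C D P Q} → φ G v P → φ G v Q → EdgeLt G C D P Q → Star (HeavierEdge G (φ G v) C D) P Q
  φ-link {P = P} {Q} φP φQ CD<PQ with ≡-dec Bool._≟_ P Q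
  ... | yes refl = ε
  ... | no P≢Q = ((φP , φQ , P≢Q , v , x∈p∩q⁺ (proj₂ φP , proj₂ φQ)) , CD<PQ) ◅ ε

  project-heavier : ∀ {C D X Y} → HeavierEdge G (IsMaxClique G) C D X Y →
                    Star (HeavierEdge G (φ G v) C D) (project X) (project Y)
  project-heavier {X = X} {Y} ((mX , mY , X≢Y , meet) , CD<XY) with blocked? G (X ∩ Y) v
  ... | yes (u , u∈X∩Y , u-far) with x∈p∩q⁻ X Y u∈X∩Y
  ...   | u∈X , u∈Y = subst (Star _ (project X)) (project-shared-far mX mY u∈X u∈Y u-far) ε
  project-heavier {X = X} {Y} ((mX , mY , X≢Y , meet) , CD<XY) | no noneFar with v ∈? X ∩ Y
  ... | yes v∈X∩Y with x∈p∩q⁻ X Y v∈X∩Y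
  ...   | v∈X , v∈Y =
    subst₂ (Star _) (sym (project-∈ v∈X)) (sym (project-∈ v∈Y))
      ((((mX , v∈X) , (mY , v∈Y) , X≢Y , meet) , CD<XY) ◅ ε)
  project-heavier {X = X} {Y} ((mX , mY , X≢Y , meet) , CD<XY) | no noneFar | no v∉X∩Y =
    φ-link (project-φ mX) (project-φ mY)
      (EdgeLt-by-weight G CD<XY (p⊂q⇒∣p∣<∣q∣ (common , v , v∈projections , v∉X∩Y)))
    where
      common : X ∩ Y ⊆ project X ∩ project Y
      common u∈X∩Y with x∈p∩q⁻ X Y u∈X∩Y
      ... | u∈X , u∈Y = x∈p∩q⁺ (project-keeps mX u∈X near , project-keeps mY u∈Y near)
        where
          near = λ u-far → noneFar (_ , u∈X∩Y , u-far)

      v∈projections : v ∈ project X ∩ project Y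
      v∈projections = x∈p∩q⁺ (proj₂ (project-φ mX) , proj₂ (project-φ mY))

  project-path : ∀ {C D X Y} → Star (HeavierEdge G (IsMaxClique G) C D) X Y →
                 Star (HeavierEdge G (φ G v) C D) (project X) (project Y)
  project-path = kleisliStar project project-heavier

lemma4 : (G : Graph) → Chordal G → (v : Fin (Graph.n G)) → (C D : Subset (Graph.n G)) →
    InMSF G (φ G v) C D ⇔ (InCliqueForest G C D × v ∈ C × v ∈ D)
lemma4 G chordal v C D = mk⇔ to from
  where
    open Projection G chordal v

    to : InMSF G (φ G v) C D → InCliqueForest G C D × v ∈ C × v ∈ D
    to (CD@((_ , v∈C) , (_ , v∈D) , _) , noPath) =
      (WEdge-mono G proj₁ CD , noPath ∘ subst₂ (Star _) (project-∈ v∈C) (project-∈ v∈D) ∘ project-path) ,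
      v∈C , v∈D

    from : InCliqueForest G C D × v ∈ C × v ∈ D → InMSF G (φ G v) C D
    from (((mC , mD , C≢D , meet) , noPath) , v∈C , v∈D) =
      ((mC , v∈C) , (mD , v∈D) , C≢D , meet) ,
      noPath ∘ gmap id (map₁ (WEdge-mono G proj₁))
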